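{- Let $h \geq 3$ be an integer and let $A = \{a_1, \ldots, a_{h+1}\}$ be a set of odd positive integers with $a_1 < \cdots < a_{h+1}$. Let $A_{h+1} = A \setminus \{a_{h+1}\}$. Then \[|h^{\wedge}_{\pm}A| \geq |h^{\wedge}_{\pm}A_{h+1}| + 2h + 2,\] and consequently $|h^{\wedge}_{\pm}A| \geq h^2 + 2h + 1$.
   Context: For a finite set $A = \{a_1, \ldots, a_k\}$ of integers (with distinct $a_i$) and a positive integer $h$, the restricted $h$-fold signed sumset is \[h^{\wedge}_{\pm}A = \left\{ \sum_{i=1}^{k} \lambda_i a_i : \lambda_i \in \{ -1,0,1\}, \ \sum_{i=1}^{k} |\lambda_i| = h \right\}.\] -}

module Defs where

open import Data.Nat using (ℕ; zero; suc)
open import Data.Integer using (ℤ; +_; -_; _+_)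
open import Data.Integer.Properties using (_≟_)
open import Data.List using (List; []; _∷_; _++_; map; length; concatMap; filter; deduplicate)
open import Data.Nat.Properties using () renaming (_≟_ to _≟ℕ_)
open import Data.Product using (_×_; _,_; proj₁; proj₂)
open import Data.Fin using (Fin; zero; suc)
open import Function using (_∘_)

data Sign : Set where
  neg zer pos : Sign

signs : List Sign
signs = neg ∷ zer ∷ pos ∷ []

weight : Sign → ℕ
weight neg = 1
weight zer = 0
weight pos = 1

apply : Sign → ℤ → ℤ
apply neg a = - a
apply zer a = + 0
apply pos a = a

signedSums : List ℤ → List (ℕ × ℤ)
signedSums [] = (0 , + 0) ∷ []
signedSums (a ∷ as) =
  concatMap (λ s → map (λ p → (weight s Data.Nat.+ proj₁ p , apply s a + proj₂ p)) (signedSums as)) signs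

-- The restricted h-fold signed sumset h^∧_± A, as a list (possibly with repetitions)
-- of integers, where A = {a_1,…,a_k} is given by the list of its (distinct) elements.
restrictedSignedSumset : ℕ → List ℤ → List ℤ
restrictedSignedSumset h as =
  map proj₂ (filter (λ p → proj₁ p ≟ℕ h) (signedSums as))

card : List ℤ → ℕ
card xs = length (deduplicate _≟_ xs)

toList : ∀ {n} → (Fin n → ℕ) → List ℤ
toList {zero} f = []
toList {suc n} f = + f zero ∷ toList (f ∘ suc)

{-# OPTIONS --safe #-}

-- Write A = B ∪ {a} with B = {b₁ < b₂ < … < c} and a > c. An element of h^∧_± B uses every element
-- of B, so it is ΣB − 2t for a subset sum t of B; hence ±(a + ΣB − m) lies in h^∧_± B only if
-- m = a + 2t for some subset sum t. This rules out m ∈ B (as m < a) and m = c + 2s, where s = b₁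
-- unless a = c + 2b₁ and s = b₂ otherwise: the only subset sum below b₁ is 0, those below b₁ + b₂
-- are 0 or single (odd) elements, and parity does the rest. All these 2h + 2 integers lie in h^∧_± A
-- (count a positively and omit one element of B, or omit c and negate s), which gives the first bound.
-- For the second, |h^∧_± B| is the number of subset sums of B, which is at least h² − 1: when a new
-- largest odd element a joins a list of n ≥ 3 elements, the sums a + Σ avoid the 2n + 1 old sums 0,
-- b_i, b₁ + b_j and b₁ + b₂ + c (b₂ + c if a = b₁ + b₂ + c), so the number of subset sums grows by 2n + 1.
module Submission where

open import Defs
open import Data.Nat using (ℕ; suc; _+_; _*_; _≤_; _<_; _%_)
open import Data.Fin using (Fin; zero; suc; inject₁)
open import Function using (_∘_)
open import Relation.Binary.PropositionalEquality using (_≡_)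
open import Data.Product using (_×_)

open import Data.Nat using (zero; z≤n; s≤s)
open import Data.Nat.Properties
open import Data.Nat.DivMod using (%-distribˡ-+)
open import Data.Nat.ListAction using (sum)
open import Data.Nat.ListAction.Properties using (sum-++)
open import Data.Nat.Tactic.RingSolver using (solve-∀)
open import Data.Integer as ℤ using (ℤ; +_; -_; _⊖_)
import Data.Integer.Properties as ℤ
open import Data.Fin using (fromℕ)
open import Data.Fin.Properties using (injective⇒≤)
open import Data.List using (List; []; _∷_; _++_; _∷ʳ_; [_]; map; length; lookup; tabulate)
open import Data.List.Properties using (length-++; length-map; length-tabulate)
open import Data.List.Membership.Propositional using (_∈_; _∉_)
open import Data.List.Membership.Propositional.Properties
open import Data.List.Relation.Binary.Subset.Propositional using (_⊆_)
open import Data.List.Relation.Binary.Disjoint.Propositional using (Disjoint)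
open import Data.List.Relation.Unary.Any as Any using (here; there)
open import Data.List.Relation.Unary.Any.Properties using (lookup-index)
open import Data.List.Relation.Unary.All as All using (All; []; _∷_)
import Data.List.Relation.Unary.All.Properties as Allₚ
open import Data.List.Relation.Unary.AllPairs as AllPairs using (AllPairs; []; _∷_)
open import Data.List.Relation.Unary.Linked using (Linked; [-]; _∷_)
open import Data.List.Relation.Unary.Linked.Properties using (Linked⇒AllPairs)
open import Data.List.Relation.Unary.Unique.Propositional using (Unique)
import Data.List.Relation.Unary.Unique.Propositional.Properties as Unique
open import Data.List.Relation.Unary.Unique.DecPropositional.Properties ℤ._≟_ using (deduplicate-!)
open import Data.List.Reverse using (Reverse; []; _∶_∶ʳ_; reverseView)
open import Data.Product as Product using (∃; ∃₂; ∃-syntax; _,_; -,_; proj₁; proj₂; uncurry)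
open import Data.Sum as Sum using (_⊎_; inj₁; inj₂; [_,_]′)
open import Data.Empty using (⊥-elim)
open import Function.Definitions using (Injective)
open import Relation.Binary.PropositionalEquality
  using (refl; sym; trans; cong; cong₂; subst; subst₂; _≢_; module ≡-Reasoning)
open import Relation.Nullary using (¬_; yes; no)

variable
  A : Set
  a b b₁ b₂ c d k l m n p s t u : ℕ
  bs ms ss ts : List ℕ
  zs : List ℤ
  x : ℤ

-[+m]+[n⊖o]≡n⊖[m+o] : ∀ m n o → - + m ℤ.+ (n ⊖ o) ≡ n ⊖ (m + o)
-[+m]+[n⊖o]≡n⊖[m+o] zero    n o = ℤ.+-identityˡ (n ⊖ o)
-[+m]+[n⊖o]≡n⊖[m+o] (suc m) n o = ℤ.distribʳ-⊖-+-neg m n o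

+-exchange : ∀ m n o → m + (n + o) ≡ n + (m + o)
+-exchange = solve-∀

m⊖n≡p⊖q⇒m+q≡p+n : ∀ m n p q → m ⊖ n ≡ p ⊖ q → m + q ≡ p + n
m⊖n≡p⊖q⇒m+q≡p+n m n p q eq = ℤ.+-injective (begin
  + (m + q)              ≡⟨ sym ([m⊖n]+[n+o]≡m+o m n q) ⟩
  (m ⊖ n) ℤ.+ + (n + q)  ≡⟨ cong₂ (λ i j → i ℤ.+ + j) eq (+-comm n q) ⟩
  (p ⊖ q) ℤ.+ + (q + n)  ≡⟨ [m⊖n]+[n+o]≡m+o p q n ⟩
  + (p + n)              ∎)
  where
  open ≡-Reasoning
  [m⊖n]+[n+o]≡m+o : ∀ m n o → (m ⊖ n) ℤ.+ + (n + o) ≡ + (m + o)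
  [m⊖n]+[n+o]≡m+o m n o = begin
    (m ⊖ n) ℤ.+ + (n + o)   ≡⟨ ℤ.distribˡ-⊖-+-pos (n + o) m n ⟩
    (m + (n + o)) ⊖ n       ≡⟨ cong₂ _⊖_ (+-exchange m n o) (sym (+-identityʳ n)) ⟩
    (n + (m + o)) ⊖ (n + 0) ≡⟨ ℤ.+-cancelˡ-⊖ n (m + o) 0 ⟩
    + (m + o)               ∎

m+q≡p+n⇒m⊖n≡p⊖q : ∀ m n p q → m + q ≡ p + n → m ⊖ n ≡ p ⊖ q
m+q≡p+n⇒m⊖n≡p⊖q m n p q eq = begin
  m ⊖ n              ≡⟨ sym (ℤ.+-cancelˡ-⊖ q m n) ⟩
  (q + m) ⊖ (q + n)  ≡⟨ cong₂ _⊖_ (trans (+-comm q m) (trans eq (+-comm p n))) (+-comm q n) ⟩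
  (n + p) ⊖ (n + q)  ≡⟨ ℤ.+-cancelˡ-⊖ n p q ⟩
  p ⊖ q              ∎
  where open ≡-Reasoning

-- A record rather than n % 2 ≡ 1, so that n can be inferred from a proof of Odd n.
record Odd (n : ℕ) : Set where
  constructor odd
  field n%2≡1 : n % 2 ≡ 1

odd⇒>0 : Odd n → 0 < n
odd⇒>0 {suc n} _ = s≤s z≤n

odd+odd-even : Odd m → Odd n → (m + n) % 2 ≡ 0
odd+odd-even {m} {n} (odd m%2≡1) (odd n%2≡1) =
  trans (%-distribˡ-+ m n 2) (cong₂ (λ i j → (i + j) % 2) m%2≡1 n%2≡1)

odd+odd≢odd : Odd l → Odd m → Odd n → l + m ≢ n
odd+odd≢odd l-odd m-odd (odd n%2≡1) l+m≡n =
  0≢1+n (trans (sym (odd+odd-even l-odd m-odd)) (trans (cong (_% 2) l+m≡n) n%2≡1))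

odd+odd+odd : Odd l → Odd m → Odd n → Odd (l + (m + n))
odd+odd+odd {l} {m} {n} (odd l%2≡1) m-odd n-odd =
  odd (trans (%-distribˡ-+ l (m + n) 2) (cong₂ (λ i j → (i + j) % 2) l%2≡1 (odd+odd-even m-odd n-odd)))

c+m≡a+n⇒c<a⇒n<m : c + m ≡ a + n → c < a → n < m
c+m≡a+n⇒c<a⇒n<m {c} {m} {a} {n} eq c<a = +-cancelˡ-< a n m (begin-strict
  a + n  ≡⟨ sym eq ⟩
  c + m  <⟨ +-monoˡ-< m c<a ⟩
  a + m  ∎)
  where open ≤-Reasoning

∈⇒≤sum : n ∈ bs → n ≤ sum bs
∈⇒≤sum {bs = b ∷ bs} (here refl) = m≤m+n b (sum bs)
∈⇒≤sum {bs = b ∷ bs} (there n∈) = ≤-trans (∈⇒≤sum n∈) (m≤n+m (sum bs) b)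

length-∷ʳ : ∀ (xs : List A) y → length (xs ∷ʳ y) ≡ suc (length xs)
length-∷ʳ xs y = trans (length-++ xs) (+-comm (length xs) 1)

sum-∷ʳ : ∀ ns n → sum (ns ∷ʳ n) ≡ sum ns + n
sum-∷ʳ ns n = trans (sum-++ ns [ n ]) (cong (_+_ (sum ns)) (+-identityʳ n))

AllPairs-∷ʳ⁻ : ∀ {R : A → A → Set} {y} xs → AllPairs R (xs ∷ʳ y) → AllPairs R xs × All (λ x → R x y) xs
AllPairs-∷ʳ⁻ []       _            = [] , []
AllPairs-∷ʳ⁻ (x ∷ xs) (Rx ∷ Rxs) with AllPairs-∷ʳ⁻ xs Rxs
... | Rxs′ , Rxsy = Allₚ.++⁻ˡ xs Rx ∷ Rxs′ , All.head (Allₚ.++⁻ʳ xs Rx) ∷ Rxsy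

tabulate-∷ʳ : ∀ {n} (f : Fin (suc n) → A) → tabulate f ≡ tabulate (f ∘ inject₁) ∷ʳ f (fromℕ n)
tabulate-∷ʳ {n = zero}  f = refl
tabulate-∷ʳ {n = suc n} f = cong (f zero ∷_) (tabulate-∷ʳ (f ∘ suc))

tabulate-Linked : ∀ {R : A → A → Set} {n} (f : Fin (suc n) → A) →
                  (∀ (i : Fin n) → R (f (inject₁ i)) (f (suc i))) → Linked R (tabulate f)
tabulate-Linked {n = zero}  f _     = [-]
tabulate-Linked {n = suc n} f Rf[i] = Rf[i] zero ∷ tabulate-Linked (f ∘ suc) (Rf[i] ∘ suc)

toList-tabulate : ∀ {n} (f : Fin n → ℕ) → toList f ≡ map +_ (tabulate f)
toList-tabulate {zero}  f = refl
toList-tabulate {suc n} f = cong (+ f zero ∷_) (toList-tabulate (f ∘ suc))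

∷⇒∷ʳ : ∀ (y : A) ys → ∃₂ λ zs z → y ∷ ys ≡ zs ∷ʳ z
∷⇒∷ʳ y []        = [] , y , refl
∷⇒∷ʳ y (y′ ∷ ys) with ∷⇒∷ʳ y′ ys
... | zs , z , eq = y ∷ zs , z , cong (y ∷_) eq

∷ʳ-shape : 3 ≤ length bs → ∃₂ λ b₁ b₂ → ∃₂ λ R c → bs ≡ (b₁ ∷ b₂ ∷ R) ∷ʳ c
∷ʳ-shape {_ ∷ []}             (s≤s ())
∷ʳ-shape {_ ∷ _ ∷ []}         (s≤s (s≤s ()))
∷ʳ-shape {b₁ ∷ b₂ ∷ b₃ ∷ rest} _ with ∷⇒∷ʳ b₃ rest
... | R , c , eq = b₁ , b₂ , R , c , cong (λ l → b₁ ∷ b₂ ∷ l) eq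

Unique⇒lookup-injective : ∀ {xs : List A} → Unique xs → Injective _≡_ _≡_ (lookup xs)
Unique⇒lookup-injective (_ ∷ _)       {zero}  {zero}  _  = refl
Unique⇒lookup-injective (x∉xs ∷ _)    {zero}  {suc j} eq = ⊥-elim (All.lookup x∉xs (∈-lookup j) eq)
Unique⇒lookup-injective (x∉xs ∷ _)    {suc i} {zero}  eq = ⊥-elim (All.lookup x∉xs (∈-lookup i) (sym eq))
Unique⇒lookup-injective (_ ∷ xs-uniq) {suc i} {suc j} eq = cong suc (Unique⇒lookup-injective xs-uniq eq)

Unique-⊆⇒length≤ : ∀ {xs ys : List A} → Unique xs → xs ⊆ ys → length xs ≤ length ys
Unique-⊆⇒length≤ {xs = xs} {ys} xs-uniq xs⊆ys = injective⇒≤ position-injective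
  where
  position : Fin (length xs) → Fin (length ys)
  position i = Any.index (xs⊆ys (∈-lookup i))
  position-injective : Injective _≡_ _≡_ position
  position-injective {i} {j} eq = Unique⇒lookup-injective xs-uniq (begin
    lookup xs i             ≡⟨ lookup-index (xs⊆ys (∈-lookup i)) ⟩
    lookup ys (position i)  ≡⟨ cong (lookup ys) eq ⟩
    lookup ys (position j)  ≡⟨ sym (lookup-index (xs⊆ys (∈-lookup j))) ⟩
    lookup xs j             ∎)
    where open ≡-Reasoning

length≤card : ∀ {xs ys : List ℤ} → Unique xs → xs ⊆ ys → length xs ≤ card ys
length≤card xs-uniq xs⊆ys = Unique-⊆⇒length≤ xs-uniq (∈-deduplicate⁺ ℤ._≟_ ∘ xs⊆ys)

-- Signed sums

-- Signs λ ∈ {-1,0,1} for bs with k nonzero; p and n sum the elements signed +1 and -1.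
data Signing : ℕ → List ℕ → ℕ → ℕ → Set where
  []    : Signing 0 [] 0 0
  skip  : ∀ {k b bs p n} → Signing k bs p n → Signing k (b ∷ bs) p n
  plus  : ∀ {k b bs p n} → Signing k bs p n → Signing (suc k) (b ∷ bs) (b + p) n
  minus : ∀ {k b bs p n} → Signing k bs p n → Signing (suc k) (b ∷ bs) p (b + n)

data Split : List ℕ → ℕ → ℕ → Set where
  []    : Split [] 0 0
  plus  : ∀ {b bs p n} → Split bs p n → Split (b ∷ bs) (b + p) n
  minus : ∀ {b bs p n} → Split bs p n → Split (b ∷ bs) p (b + n)

SignedSum : ℕ → List ℕ → ℤ → Set
SignedSum k bs x = ∃₂ λ p n → Signing k bs p n × x ≡ p ⊖ n

SubsetSum : List ℕ → ℕ → Set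
SubsetSum bs t = ∃[ u ] Split bs u t

Signing-swap : Signing k bs p n → Signing k bs n p
Signing-swap []        = []
Signing-swap (skip σ)  = skip (Signing-swap σ)
Signing-swap (plus σ)  = minus (Signing-swap σ)
Signing-swap (minus σ) = plus (Signing-swap σ)

Signing-length : Signing k bs p n → k ≤ length bs
Signing-length []        = z≤n
Signing-length (skip σ)  = m≤n⇒m≤1+n (Signing-length σ)
Signing-length (plus σ)  = s≤s (Signing-length σ)
Signing-length (minus σ) = s≤s (Signing-length σ)

Signing-∷ʳ-skip : Signing k bs p n → Signing k (bs ∷ʳ c) p n
Signing-∷ʳ-skip []        = skip []
Signing-∷ʳ-skip (skip σ)  = skip (Signing-∷ʳ-skip σ)
Signing-∷ʳ-skip (plus σ)  = plus (Signing-∷ʳ-skip σ)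
Signing-∷ʳ-skip (minus σ) = minus (Signing-∷ʳ-skip σ)

Signing-∷ʳ-plus : Signing k bs p n → Signing (suc k) (bs ∷ʳ c) (c + p) n
Signing-∷ʳ-plus []        = plus []
Signing-∷ʳ-plus (skip σ)  = skip (Signing-∷ʳ-plus σ)
Signing-∷ʳ-plus {c = c} (plus {k} {b} {bs} {p} {n} σ) =
  subst (λ q → Signing (suc (suc k)) ((b ∷ bs) ∷ʳ c) q n) (+-exchange b c p) (plus (Signing-∷ʳ-plus σ))
Signing-∷ʳ-plus (minus σ) = minus (Signing-∷ʳ-plus σ)

Split-swap : Split bs p n → Split bs n p
Split-swap []        = []
Split-swap (plus σ)  = minus (Split-swap σ)
Split-swap (minus σ) = plus (Split-swap σ)

Split-sum : Split bs p n → p + n ≡ sum bs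
Split-sum [] = refl
Split-sum (plus {b = b} {p = p} {n = n} σ) = trans (+-assoc b p n) (cong (_+_ b) (Split-sum σ))
Split-sum (minus {b = b} {p = p} {n = n} σ) = trans (+-exchange p b n) (cong (_+_ b) (Split-sum σ))

Split-allPlus : ∀ bs → Split bs (sum bs) 0
Split-allPlus []       = []
Split-allPlus (b ∷ bs) = plus (Split-allPlus bs)

Split-∷ʳ-plus : Split bs p n → Split (bs ∷ʳ c) (c + p) n
Split-∷ʳ-plus []        = plus []
Split-∷ʳ-plus {c = c} (plus {b} {bs} {p} {n} σ) =
  subst (λ q → Split ((b ∷ bs) ∷ʳ c) q n) (+-exchange b c p) (plus (Split-∷ʳ-plus σ))
Split-∷ʳ-plus (minus σ) = minus (Split-∷ʳ-plus σ)

Split-∷ʳ-minus : Split bs p n → Split (bs ∷ʳ c) p (c + n)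
Split-∷ʳ-minus = Split-swap ∘ Split-∷ʳ-plus ∘ Split-swap

Split⇒Signing : Split bs p n → Signing (length bs) bs p n
Split⇒Signing []        = []
Split⇒Signing (plus σ)  = plus (Split⇒Signing σ)
Split⇒Signing (minus σ) = minus (Split⇒Signing σ)

Signing⇒Split : ∀ {bs} → Signing (length bs) bs p n → Split bs p n
Signing⇒Split {bs = []}    []        = []
Signing⇒Split {bs = _ ∷ _} (skip σ)  = ⊥-elim (1+n≰n (Signing-length σ))
Signing⇒Split {bs = _ ∷ _} (plus σ)  = plus (Signing⇒Split σ)
Signing⇒Split {bs = _ ∷ _} (minus σ) = minus (Signing⇒Split σ)

∈⇒SubsetSum : b ∈ bs → SubsetSum bs b
∈⇒SubsetSum {b} {bs = _ ∷ bs} (here refl) = sum bs , subst (Split _ _) (+-identityʳ b) (minus (Split-allPlus bs))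
∈⇒SubsetSum (there b∈) with ∈⇒SubsetSum b∈
... | u , σ = _ , plus σ

SignedSum-neg : SignedSum k bs x → SignedSum k bs (- x)
SignedSum-neg (p , n , σ , refl) = n , p , Signing-swap σ , sym (ℤ.⊖-swap n p)

SignedSum-∷-skip : SignedSum k bs x → SignedSum k (b ∷ bs) x
SignedSum-∷-skip (p , n , σ , eq) = p , n , skip σ , eq

SignedSum-∷-plus : SignedSum k bs x → SignedSum (suc k) (b ∷ bs) (+ b ℤ.+ x)
SignedSum-∷-plus {b = b} (p , n , σ , refl) = b + p , n , plus σ , ℤ.distribʳ-⊖-+-pos b p n

SignedSum-∷-minus : SignedSum k bs x → SignedSum (suc k) (b ∷ bs) (- + b ℤ.+ x)
SignedSum-∷-minus {b = b} (p , n , σ , refl) = p , b + n , minus σ , -[+m]+[n⊖o]≡n⊖[m+o] b p n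

SignedSum-∷ʳ-skip : SignedSum k bs x → SignedSum k (bs ∷ʳ c) x
SignedSum-∷ʳ-skip (p , n , σ , eq) = p , n , Signing-∷ʳ-skip σ , eq

SignedSum-∷ʳ-plus : SignedSum k bs x → SignedSum (suc k) (bs ∷ʳ c) (+ c ℤ.+ x)
SignedSum-∷ʳ-plus {c = c} (p , n , σ , refl) = c + p , n , Signing-∷ʳ-plus σ , ℤ.distribʳ-⊖-+-pos c p n

∈⇒SignedSum-omit : b ∈ d ∷ bs → SignedSum (length bs) (d ∷ bs) (sum (d ∷ bs) ⊖ b)
∈⇒SignedSum-omit {b} {bs = bs} (here refl) =
  sum bs , 0 , skip (Split⇒Signing (Split-allPlus bs)) ,
  m+q≡p+n⇒m⊖n≡p⊖q (b + sum bs) b (sum bs) 0 (trans (+-identityʳ (b + sum bs)) (+-comm b (sum bs)))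
∈⇒SignedSum-omit {b} {d} {bs = e ∷ bs} (there b∈) =
  subst (SignedSum _ _) (ℤ.distribʳ-⊖-+-pos d (sum (e ∷ bs)) b) (SignedSum-∷-plus (∈⇒SignedSum-omit b∈))

private
  signEntry : ℤ → Sign → ℕ × ℤ → ℕ × ℤ
  signEntry y s q = weight s + proj₁ q , apply s y ℤ.+ proj₂ q

  signEntries : ℤ → List ℤ → Sign → List (ℕ × ℤ)
  signEntries y ys s = map (signEntry y s) (signedSums ys)

  ∈signedSums-∷ : ∀ {b bs k x y} s → apply s (+ b) ℤ.+ x ≡ y → (k , x) ∈ signedSums (map +_ bs) → s ∈ signs →
                  (weight s + k , y) ∈ signedSums (map +_ (b ∷ bs))
  ∈signedSums-∷ {b} {bs} s refl k,x∈ s∈ =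
    ∈-concatMap⁺ (signEntries (+ b) (map +_ bs))
                 (Any.map (λ { refl → ∈-map⁺ (signEntry (+ b) s) k,x∈ }) s∈)

∈signedSums⇒SignedSum : ∀ {k x} bs → (k , x) ∈ signedSums (map +_ bs) → SignedSum k bs x
∈signedSums⇒SignedSum [] (here refl) = 0 , 0 , [] , refl
∈signedSums⇒SignedSum (b ∷ bs) k,x∈ with ∈-concatMap⁻ (signEntries (+ b) (map +_ bs)) {xs = signs} k,x∈
... | here k,x∈′ with ∈-map⁻ (signEntry (+ b) neg) k,x∈′
...   | _ , k′,x′∈ , refl = SignedSum-∷-minus (∈signedSums⇒SignedSum bs k′,x′∈)
∈signedSums⇒SignedSum (b ∷ bs) _ | there (here k,x∈′) with ∈-map⁻ (signEntry (+ b) zer) k,x∈′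
...   | (_ , x′) , k′,x′∈ , refl =
  subst (SignedSum _ _) (sym (ℤ.+-identityˡ x′)) (SignedSum-∷-skip (∈signedSums⇒SignedSum bs k′,x′∈))
∈signedSums⇒SignedSum (b ∷ bs) _ | there (there (here k,x∈′)) with ∈-map⁻ (signEntry (+ b) pos) k,x∈′
...   | _ , k′,x′∈ , refl = SignedSum-∷-plus (∈signedSums⇒SignedSum bs k′,x′∈)

Signing⇒∈signedSums : Signing k bs p n → (k , p ⊖ n) ∈ signedSums (map +_ bs)
Signing⇒∈signedSums [] = here refl
Signing⇒∈signedSums (minus {b = b} {bs} {p} {n} σ) =
  ∈signedSums-∷ {b} {bs} neg (-[+m]+[n⊖o]≡n⊖[m+o] b p n) (Signing⇒∈signedSums σ) (here refl)
Signing⇒∈signedSums (skip {b = b} {bs} {p} {n} σ) =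
  ∈signedSums-∷ {b} {bs} zer (ℤ.+-identityˡ (p ⊖ n)) (Signing⇒∈signedSums σ) (there (here refl))
Signing⇒∈signedSums (plus {b = b} {bs} {p} {n} σ) =
  ∈signedSums-∷ {b} {bs} pos (ℤ.distribʳ-⊖-+-pos b p n) (Signing⇒∈signedSums σ) (there (there (here refl)))

∈restricted⇒SignedSum : ∀ {h x} bs → x ∈ restrictedSignedSumset h (map +_ bs) → SignedSum h bs x
∈restricted⇒SignedSum {h} bs x∈ with ∈-map⁻ proj₂ x∈
... | _ , k,x∈ , refl with ∈-filter⁻ (λ q → proj₁ q ≟ h) k,x∈
...   | k,x∈′ , refl = ∈signedSums⇒SignedSum bs k,x∈′

SignedSum⇒∈restricted : ∀ {h} → SignedSum h bs x → x ∈ restrictedSignedSumset h (map +_ bs)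
SignedSum⇒∈restricted {h = h} (_ , _ , σ , refl) =
  ∈-map⁺ proj₂ (∈-filter⁺ (λ q → proj₁ q ≟ h) (Signing⇒∈signedSums σ) refl)

-- Subset sums

AllPairs⇒head≤ : AllPairs _<_ (b ∷ bs) → All (b ≤_) (b ∷ bs)
AllPairs⇒head≤ (b<bs ∷ _) = ≤-refl ∷ All.map <⇒≤ b<bs

subsetSum≡0⊎≥ : All (m ≤_) bs → SubsetSum bs t → t ≡ 0 ⊎ m ≤ t
subsetSum≡0⊎≥ []         (_ , [])      = inj₁ refl
subsetSum≡0⊎≥ (_ ∷ m≤bs) (_ , plus σ)  = subsetSum≡0⊎≥ m≤bs (_ , σ)
subsetSum≡0⊎≥ (m≤b ∷ _)  (_ , minus {b} {n = n} σ) = inj₂ (≤-trans m≤b (m≤m+n b n))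

subsetSum≡0⊎∈⊎≥ : All (m ≤_) bs → SubsetSum bs t → t ≡ 0 ⊎ t ∈ bs ⊎ m + m ≤ t
subsetSum≡0⊎∈⊎≥ []           (_ , [])     = inj₁ refl
subsetSum≡0⊎∈⊎≥ (_ ∷ m≤bs)   (_ , plus σ) = Sum.map₂ (Sum.map₁ there) (subsetSum≡0⊎∈⊎≥ m≤bs (_ , σ))
subsetSum≡0⊎∈⊎≥ (m≤b ∷ m≤bs) (_ , minus {b} σ) with subsetSum≡0⊎≥ m≤bs (_ , σ)
... | inj₁ refl = inj₂ (inj₁ (here (+-identityʳ b)))
... | inj₂ m≤n  = inj₂ (inj₂ (+-mono-≤ m≤b m≤n))

subsetSum<b₁⇒≡0 : AllPairs _<_ (b₁ ∷ bs) → SubsetSum (b₁ ∷ bs) t → t < b₁ → t ≡ 0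
subsetSum<b₁⇒≡0 sorted t∈ t<b₁ =
  Sum.fromInj₁ (λ b₁≤t → ⊥-elim (<⇒≱ t<b₁ b₁≤t)) (subsetSum≡0⊎≥ (AllPairs⇒head≤ sorted) t∈)

subsetSum<b₁+b₂⇒≡0⊎∈ : AllPairs _<_ (b₁ ∷ b₂ ∷ bs) → SubsetSum (b₁ ∷ b₂ ∷ bs) t → t < b₁ + b₂ →
                       t ≡ 0 ⊎ t ∈ b₁ ∷ b₂ ∷ bs
subsetSum<b₁+b₂⇒≡0⊎∈ {b₁} {b₂} ((b₁<b₂ ∷ _) ∷ sorted) (_ , plus σ) t<
  with subsetSum≡0⊎∈⊎≥ (AllPairs⇒head≤ sorted) (_ , σ)
... | inj₁ t≡0          = inj₁ t≡0
... | inj₂ (inj₁ t∈)    = inj₂ (there t∈)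
... | inj₂ (inj₂ 2b₂≤t) = ⊥-elim (<⇒≱ t< (≤-trans (+-monoˡ-≤ b₂ (<⇒≤ b₁<b₂)) 2b₂≤t))
subsetSum<b₁+b₂⇒≡0⊎∈ {b₁} (_ ∷ sorted) (_ , minus σ) t<
  with subsetSum≡0⊎≥ (AllPairs⇒head≤ sorted) (_ , σ)
... | inj₁ refl = inj₂ (here (+-identityʳ b₁))
... | inj₂ b₂≤n = ⊥-elim (<⇒≱ t< (+-monoʳ-≤ b₁ b₂≤n))

DistinctSubsetSums : List ℕ → List ℕ → Set
DistinctSubsetSums bs ts = Unique ts × All (SubsetSum bs) ts

infix 4 _∉_+Σ_
_∉_+Σ_ : ℕ → ℕ → List ℕ → Set
s ∉ a +Σ bs = ∀ {t} → SubsetSum bs t → s ≢ a + t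

subsetSums-∷ʳ : DistinctSubsetSums bs ts → DistinctSubsetSums bs ss → All (_∉ a +Σ bs) ss →
                DistinctSubsetSums (bs ∷ʳ a) (map (_+_ a) ts ++ ss)
subsetSums-∷ʳ {ts = ts} {ss = ss} {a = a} (ts-unique , ts-sums) (ss-unique , ss-sums) ss∉ =
  Unique.++⁺ (Unique.map⁺ (λ {x} {y} → +-cancelˡ-≡ a x y) ts-unique) ss-unique disjoint ,
  Allₚ.++⁺ (Allₚ.map⁺ (All.map (Product.map₂ Split-∷ʳ-minus) ts-sums))
           (All.map (Product.map (_+_ a) Split-∷ʳ-plus) ss-sums)
  where
  disjoint : Disjoint (map (_+_ a) ts) ss
  disjoint (x∈ , x∈ss) with ∈-map⁻ (_+_ a) x∈
  ... | t , t∈ , refl = All.lookup ss∉ x∈ss (All.lookup ts-sums t∈) refl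

smallSubsetSums : ℕ → List ℕ → List ℕ
smallSubsetSums b bs = 0 ∷ (b ∷ bs) ++ map (_+_ b) bs

length-smallSubsetSums : ∀ b bs → length (smallSubsetSums b bs) ≡ 2 * length (b ∷ bs)
length-smallSubsetSums b bs = begin
  suc (length ((b ∷ bs) ++ map (_+_ b) bs))     ≡⟨ cong suc (length-++ (b ∷ bs)) ⟩
  suc (suc (length bs) + length (map (_+_ b) bs)) ≡⟨ cong (λ l → suc (suc (length bs) + l)) (length-map (_+_ b) bs) ⟩
  suc (suc (length bs) + length bs)              ≡⟨ double (length bs) ⟩
  2 * suc (length bs)                            ∎
  where
  open ≡-Reasoning
  double : ∀ l → suc (suc l + l) ≡ 2 * suc l
  double = solve-∀

smallSubsetSums-distinct : AllPairs _<_ (b ∷ bs) → All Odd (b ∷ bs) →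
                           DistinctSubsetSums (b ∷ bs) (smallSubsetSums b bs)
smallSubsetSums-distinct {b} {bs} sorted@(_ ∷ bs-sorted) odds@(b-odd ∷ bs-odd) =
  All.map <⇒≢ positive ∷ Unique.++⁺ (AllPairs.map <⇒≢ sorted) shifted-unique disjoint ,
  (-, Split-allPlus (b ∷ bs)) ∷
    Allₚ.++⁺ (All.tabulate ∈⇒SubsetSum) (Allₚ.map⁺ (All.tabulate (Product.map₂ minus ∘ ∈⇒SubsetSum)))
  where
  shifted-unique : Unique (map (_+_ b) bs)
  shifted-unique = Unique.map⁺ (λ {x} {y} → +-cancelˡ-≡ b x y) (AllPairs.map <⇒≢ bs-sorted)
  positive : All (0 <_) ((b ∷ bs) ++ map (_+_ b) bs)
  positive = Allₚ.++⁺ (All.map odd⇒>0 odds)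
                      (Allₚ.map⁺ (All.map (λ {y} _ → <-≤-trans (odd⇒>0 b-odd) (m≤m+n b y)) bs-odd))
  disjoint : Disjoint (b ∷ bs) (map (_+_ b) bs)
  disjoint (x∈ , x∈′) with ∈-map⁻ (_+_ b) x∈′
  ... | y , y∈ , refl = odd+odd≢odd b-odd (All.lookup bs-odd y∈) (All.lookup odds x∈) refl

smallSubsetSums-∉ : AllPairs _<_ (b ∷ bs) → All Odd (b ∷ bs) → All (_< a) (b ∷ bs) → Odd a →
                    All (_∉ a +Σ (b ∷ bs)) (smallSubsetSums b bs)
smallSubsetSums-∉ {b} {bs} {a} sorted (b-odd ∷ bs-odd) <a a-odd =
  0∉ ∷ Allₚ.++⁺ (All.map element∉ <a) (Allₚ.map⁺ (All.tabulate pair∉))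
  where
  0∉ : 0 ∉ a +Σ (b ∷ bs)
  0∉ {t} _ eq = <⇒≢ (odd⇒>0 a-odd) (sym (m+n≡0⇒m≡0 a (sym eq)))
  element∉ : m < a → m ∉ a +Σ (b ∷ bs)
  element∉ m<a {t} _ eq = <⇒≱ m<a (≤-trans (m≤m+n a t) (≤-reflexive (sym eq)))
  pair∉ : n ∈ bs → b + n ∉ a +Σ (b ∷ bs)
  pair∉ {n} n∈ {t} t∈ eq =
    odd+odd≢odd b-odd (All.lookup bs-odd n∈) a-odd (trans eq (trans (cong (_+_ a) t≡0) (+-identityʳ a)))
    where
    t≡0 : t ≡ 0
    t≡0 = subsetSum<b₁⇒≡0 sorted t∈ (c+m≡a+n⇒c<a⇒n<m (trans (+-comm n b) eq) (All.lookup <a (there n∈)))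

-- Adding a largest element

∈⇒SignedSum-∷ʳ : b ∈ d ∷ bs → SignedSum (length (d ∷ bs)) ((d ∷ bs) ∷ʳ a) ((a + sum (d ∷ bs)) ⊖ b)
∈⇒SignedSum-∷ʳ {b} {d} {bs} {a} b∈ =
  subst (SignedSum _ _) (ℤ.distribʳ-⊖-+-pos a (sum (d ∷ bs)) b) (SignedSum-∷ʳ-plus (∈⇒SignedSum-omit b∈))

-- a signed +, c omitted, s signed −, the rest +.
∈⇒SignedSum-∷ʳ-∷ʳ : s ∈ bs →
  SignedSum (length (bs ∷ʳ c)) ((bs ∷ʳ c) ∷ʳ a) ((a + sum (bs ∷ʳ c)) ⊖ (c + 2 * s))
∈⇒SignedSum-∷ʳ-∷ʳ {s} {bs} {c} {a} s∈ with ∈⇒SubsetSum s∈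
... | u , σ = subst₂ (λ k x → SignedSum k ((bs ∷ʳ c) ∷ʳ a) x) (sym (length-∷ʳ bs c)) value
                (SignedSum-∷ʳ-plus (SignedSum-∷ʳ-skip (u , s , Split⇒Signing σ , refl)))
  where
  open ≡-Reasoning
  rearrange : ∀ a u c s → a + u + (c + 2 * s) ≡ a + (u + s + c) + s
  rearrange = solve-∀
  value : + a ℤ.+ (u ⊖ s) ≡ (a + sum (bs ∷ʳ c)) ⊖ (c + 2 * s)
  value = begin
    + a ℤ.+ (u ⊖ s)                    ≡⟨ ℤ.distribʳ-⊖-+-pos a u s ⟩
    (a + u) ⊖ s                        ≡⟨ m+q≡p+n⇒m⊖n≡p⊖q (a + u) s _ (c + 2 * s) (begin
      a + u + (c + 2 * s)                ≡⟨ rearrange a u c s ⟩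
      a + (u + s + c) + s                ≡⟨ cong (λ Σ → a + (Σ + c) + s) (Split-sum σ) ⟩
      a + (sum bs + c) + s               ≡⟨ cong (λ Σ → a + Σ + s) (sym (sum-∷ʳ bs c)) ⟩
      a + sum (bs ∷ʳ c) + s              ∎) ⟩
    (a + sum (bs ∷ʳ c)) ⊖ (c + 2 * s)  ∎

infixr 5 _±⊖_
_±⊖_ : ℕ → List ℕ → List ℤ
K ±⊖ ms = map (K ⊖_) ms ++ map (_⊖ K) ms

length-±⊖ : ∀ K ms → length (K ±⊖ ms) ≡ 2 * length ms
length-±⊖ K ms = begin
  length (map (K ⊖_) ms ++ map (_⊖ K) ms)        ≡⟨ length-++ (map (K ⊖_) ms) ⟩
  length (map (K ⊖_) ms) + length (map (_⊖ K) ms) ≡⟨ cong₂ _+_ (length-map (K ⊖_) ms) (length-map (_⊖ K) ms) ⟩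
  length ms + length ms                          ≡⟨ cong (_+_ (length ms)) (sym (+-identityʳ (length ms))) ⟩
  2 * length ms                                  ∎
  where open ≡-Reasoning

±⊖-unique : ∀ {K} → Unique ms → All (_< K) ms → Unique (K ±⊖ ms)
±⊖-unique {ms} {K} ms-unique ms<K =
  Unique.++⁺ (Unique.map⁺ ⊖-injectiveʳ ms-unique) (Unique.map⁺ ⊖-injectiveˡ ms-unique) disjoint
  where
  ⊖-injectiveʳ : K ⊖ m ≡ K ⊖ n → m ≡ n
  ⊖-injectiveʳ {m} {n} eq = sym (+-cancelˡ-≡ K n m (m⊖n≡p⊖q⇒m+q≡p+n K m K n eq))
  ⊖-injectiveˡ : m ⊖ K ≡ n ⊖ K → m ≡ n
  ⊖-injectiveˡ {m} {n} eq = +-cancelʳ-≡ K m n (m⊖n≡p⊖q⇒m+q≡p+n m K n K eq)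
  disjoint : Disjoint (map (K ⊖_) ms) (map (_⊖ K) ms)
  disjoint (x∈ , x∈′) with ∈-map⁻ (K ⊖_) x∈ | ∈-map⁻ (_⊖ K) x∈′
  ... | m , m∈ , refl | n , n∈ , eq =
    <-irrefl (sym (m⊖n≡p⊖q⇒m+q≡p+n K m n K eq)) (+-mono-< (All.lookup ms<K n∈) (All.lookup ms<K m∈))

±⊖-SignedSum : ∀ {K} → All (λ m → SignedSum k bs (K ⊖ m)) ms → All (SignedSum k bs) (K ±⊖ ms)
±⊖-SignedSum {K = K} signed =
  Allₚ.++⁺ (Allₚ.map⁺ signed)
           (Allₚ.map⁺ (All.map (λ {m} → subst (SignedSum _ _) (sym (ℤ.⊖-swap m K)) ∘ SignedSum-neg) signed))

infix 4 _∉_+2Σ_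
_∉_+2Σ_ : ℕ → ℕ → List ℕ → Set
m ∉ a +2Σ bs = ∀ {t} → SubsetSum bs t → m ≢ a + 2 * t

±⊖-∉ : All (_∉ a +2Σ bs) ms → All (λ x → ¬ SignedSum (length bs) bs x) ((a + sum bs) ±⊖ ms)
±⊖-∉ {a} {bs} fresh = Allₚ.++⁺ (Allₚ.map⁺ (All.map ⊖m∉ fresh)) (Allₚ.map⁺ (All.map m⊖∉ fresh))
  where
  K : ℕ
  K = a + sum bs
  m≡a+2n : Split bs p n → K + n ≡ p + m → m ≡ a + 2 * n
  m≡a+2n {p} {n} {m} σ eq = +-cancelˡ-≡ p m (a + 2 * n) (begin
    p + m             ≡⟨ sym eq ⟩
    a + sum bs + n    ≡⟨ cong (λ Σ → a + Σ + n) (sym (Split-sum σ)) ⟩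
    a + (p + n) + n   ≡⟨ rearrange a p n ⟩
    p + (a + 2 * n)   ∎)
    where
    open ≡-Reasoning
    rearrange : ∀ a p n → a + (p + n) + n ≡ p + (a + 2 * n)
    rearrange = solve-∀
  ⊖m∉ : m ∉ a +2Σ bs → ¬ SignedSum (length bs) bs (K ⊖ m)
  ⊖m∉ {m} m-fresh (p , n , σ , eq) =
    m-fresh (p , Signing⇒Split σ) (m≡a+2n (Signing⇒Split σ) (m⊖n≡p⊖q⇒m+q≡p+n K m p n eq))
  m⊖∉ : m ∉ a +2Σ bs → ¬ SignedSum (length bs) bs (m ⊖ K)
  m⊖∉ {m} m-fresh = ⊖m∉ m-fresh ∘ subst (SignedSum _ _) (sym (ℤ.⊖-swap K m)) ∘ SignedSum-neg

card-signedSumset-∷ʳ-±⊖ : Unique ms → All (_< a + sum bs) ms → All (_∉ a +2Σ bs) ms →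
            All (λ m → SignedSum (length bs) (bs ∷ʳ a) ((a + sum bs) ⊖ m)) ms →
            Unique zs → All (SignedSum (length bs) bs) zs →
            length zs + 2 * length ms ≤ card (restrictedSignedSumset (length bs) (map +_ (bs ∷ʳ a)))
card-signedSumset-∷ʳ-±⊖ {ms = ms} {a = a} {bs = bs} {zs = zs}
                        ms-unique ms<K ms-fresh ms-signed zs-unique zs-signed = begin
  length zs + 2 * length ms  ≡⟨ cong (_+_ (length zs)) (sym (length-±⊖ K ms)) ⟩
  length zs + length new     ≡⟨ sym (length-++ zs) ⟩
  length (zs ++ new)         ≤⟨ length≤card (Unique.++⁺ zs-unique (±⊖-unique ms-unique ms<K) disjoint)
                                             (SignedSum⇒∈restricted ∘ All.lookup all-signed) ⟩
  card (restrictedSignedSumset (length bs) (map +_ (bs ∷ʳ a))) ∎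
  where
  open ≤-Reasoning
  K : ℕ
  K = a + sum bs
  new : List ℤ
  new = K ±⊖ ms
  disjoint : Disjoint zs new
  disjoint (x∈zs , x∈new) = All.lookup (±⊖-∉ ms-fresh) x∈new (All.lookup zs-signed x∈zs)
  all-signed : All (SignedSum (length bs) (bs ∷ʳ a)) (zs ++ new)
  all-signed = Allₚ.++⁺ (All.map SignedSum-∷ʳ-skip zs-signed) (±⊖-SignedSum ms-signed)

module _ {b₁ b₂ c a : ℕ} {R : List ℕ}
         (sorted : AllPairs _<_ ((b₁ ∷ b₂ ∷ R) ∷ʳ c))
         (odds : All Odd ((b₁ ∷ b₂ ∷ R) ∷ʳ c))
         (c<a : c < a)
         where

  private
    B : List ℕ
    B = (b₁ ∷ b₂ ∷ R) ∷ʳ c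

    b₁<b₂ : b₁ < b₂
    b₁<b₂ = All.head (AllPairs.head sorted)

    b₁-odd : Odd b₁
    b₁-odd = All.head odds

    b₂-odd : Odd b₂
    b₂-odd = All.head (All.tail odds)

    c-odd : Odd c
    c-odd = All.lookup odds (∈-++⁺ʳ (b₁ ∷ b₂ ∷ R) (here refl))

    ≤c : All (_≤ c) B
    ≤c = Allₚ.++⁺ (All.map <⇒≤ (proj₂ (AllPairs-∷ʳ⁻ (b₁ ∷ b₂ ∷ R) sorted))) (≤-refl ∷ [])

    <a : All (_< a) B
    <a = All.map (λ m≤c → ≤-<-trans m≤c c<a) ≤c

    smallSubsetSums<b₂+c : All (_< b₂ + c) (smallSubsetSums b₁ ((b₂ ∷ R) ∷ʳ c))
    smallSubsetSums<b₂+c =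
      <-≤-trans (odd⇒>0 b₂-odd) (m≤m+n b₂ c) ∷
      Allₚ.++⁺ (All.map (λ m≤c → ≤-<-trans m≤c (m<n+m c (odd⇒>0 b₂-odd))) ≤c)
               (Allₚ.map⁺ (All.map (+-mono-<-≤ b₁<b₂) (All.tail ≤c)))

  fresh-c+2s : ∃[ s ] s ∈ b₁ ∷ b₂ ∷ R × c + 2 * s ∉ a +2Σ B
  fresh-c+2s with a ≟ c + 2 * b₁
  ... | no a≢c+2b₁ = b₁ , here refl , c+2b₁∉
    where
    c+2b₁∉ : c + 2 * b₁ ∉ a +2Σ B
    c+2b₁∉ {t} t∈ eq = a≢c+2b₁ (sym (begin
      c + 2 * b₁  ≡⟨ eq ⟩
      a + 2 * t   ≡⟨ cong (λ t → a + 2 * t) t≡0 ⟩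
      a + 0       ≡⟨ +-identityʳ a ⟩
      a           ∎))
      where
      open ≡-Reasoning
      t≡0 : t ≡ 0
      t≡0 = subsetSum<b₁⇒≡0 sorted t∈ (*-cancelˡ-< 2 t b₁ (c+m≡a+n⇒c<a⇒n<m eq c<a))
  ... | yes a≡c+2b₁ = b₂ , there (here refl) , c+2b₂∉
    where
    c+2b₂∉ : c + 2 * b₂ ∉ a +2Σ B
    c+2b₂∉ {t} t∈ eq = [ t≢0 , t∉B ]′ (subsetSum<b₁+b₂⇒≡0⊎∈ sorted t∈ t<b₁+b₂)
      where
      open ≡-Reasoning
      rearrange : ∀ c b₁ t → c + 2 * b₁ + 2 * t ≡ c + 2 * (b₁ + t)
      rearrange = solve-∀
      b₂≡b₁+t : b₂ ≡ b₁ + t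
      b₂≡b₁+t = *-cancelˡ-≡ b₂ (b₁ + t) 2 (+-cancelˡ-≡ c _ _ (begin
        c + 2 * b₂           ≡⟨ eq ⟩
        a + 2 * t            ≡⟨ cong (λ a → a + 2 * t) a≡c+2b₁ ⟩
        c + 2 * b₁ + 2 * t   ≡⟨ rearrange c b₁ t ⟩
        c + 2 * (b₁ + t)     ∎))
      t<b₁+b₂ : t < b₁ + b₂
      t<b₁+b₂ = <-≤-trans (subst (t <_) (sym b₂≡b₁+t) (m<n+m t (odd⇒>0 b₁-odd))) (m≤n+m b₂ b₁)
      t≢0 : t ≢ 0
      t≢0 t≡0 = <-irrefl (sym (trans b₂≡b₁+t (trans (cong (_+_ b₁) t≡0) (+-identityʳ b₁)))) b₁<b₂
      t∉B : t ∉ B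
      t∉B t∈B = odd+odd≢odd b₁-odd (All.lookup odds t∈B) b₂-odd (sym b₂≡b₁+t)

  extraSubsetSum : Odd a →
    ∃[ e ] SubsetSum B e × e ∉ a +Σ B × All (_< e) (smallSubsetSums b₁ ((b₂ ∷ R) ∷ʳ c))
  extraSubsetSum a-odd with ∈⇒SubsetSum (∈-++⁺ʳ R (here {x = c} refl)) | a ≟ b₁ + (b₂ + c)
  ... | _ , c∈ | yes a≡b₁+b₂+c = b₂ + c , (-, plus (minus c∈)) , b₂+c∉ , smallSubsetSums<b₂+c
    where
    b₂+c∉ : b₂ + c ∉ a +Σ B
    b₂+c∉ {t} _ eq = <⇒≱ (subst (b₂ + c <_) (sym a≡b₁+b₂+c) (m<n+m (b₂ + c) (odd⇒>0 b₁-odd)))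
                         (≤-trans (m≤m+n a t) (≤-reflexive (sym eq)))
  ... | _ , c∈ | no a≢b₁+b₂+c =
    b₁ + (b₂ + c) , (-, minus (minus c∈)) , b₁+b₂+c∉ ,
    All.map (λ m< → <-≤-trans m< (m≤n+m (b₂ + c) b₁)) smallSubsetSums<b₂+c
    where
    b₁+b₂+c∉ : b₁ + (b₂ + c) ∉ a +Σ B
    b₁+b₂+c∉ {t} t∈ eq = [ t≢0 , t∉B ]′ (subsetSum<b₁+b₂⇒≡0⊎∈ sorted t∈ t<b₁+b₂)
      where
      rearrange : ∀ b₁ b₂ c → b₁ + (b₂ + c) ≡ c + (b₁ + b₂)
      rearrange = solve-∀
      t<b₁+b₂ : t < b₁ + b₂
      t<b₁+b₂ = c+m≡a+n⇒c<a⇒n<m (trans (sym (rearrange b₁ b₂ c)) eq) c<a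
      t≢0 : t ≢ 0
      t≢0 t≡0 = a≢b₁+b₂+c (sym (trans eq (trans (cong (_+_ a) t≡0) (+-identityʳ a))))
      t∉B : t ∉ B
      t∉B t∈B = odd+odd≢odd a-odd (All.lookup odds t∈B) (odd+odd+odd b₁-odd b₂-odd c-odd) (sym eq)

  card-signedSumset-∷ʳ : ∀ {us : List ℤ} → Unique us → All (SignedSum (length B) B) us →
    length us + (2 * length B + 2) ≤ card (restrictedSignedSumset (length B) (map +_ (B ∷ʳ a)))
  card-signedSumset-∷ʳ {us} us-unique us-signed with fresh-c+2s
  ... | s , s∈ , s-fresh =
    subst (λ l → length us + l ≤ card (restrictedSignedSumset (length B) (map +_ (B ∷ʳ a))))
          (double-suc (length B))
          (card-signedSumset-∷ʳ-±⊖ M-unique M<K M-fresh M-signed us-unique us-signed)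
    where
    double-suc : ∀ n → 2 * suc n ≡ 2 * n + 2
    double-suc = solve-∀
    M : List ℕ
    M = c + 2 * s ∷ B
    s∈B : s ∈ B
    s∈B = ∈-++⁺ˡ s∈
    c<c+2s : c < c + 2 * s
    c<c+2s = m<m+n c (<-≤-trans (odd⇒>0 (All.lookup odds s∈B)) (m≤m+n s (s + 0)))
    M-unique : Unique M
    M-unique = All.map (λ m≤c → >⇒≢ (≤-<-trans m≤c c<c+2s)) ≤c ∷ AllPairs.map <⇒≢ sorted
    c+2s<K : c + 2 * s < a + sum B
    c+2s<K = begin-strict
      c + 2 * s                   ≡⟨ rearrange c s ⟩
      s + (s + c)                 <⟨ +-mono-<-≤ (All.lookup <a s∈B) (+-monoˡ-≤ c (∈⇒≤sum s∈)) ⟩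
      a + (sum (b₁ ∷ b₂ ∷ R) + c) ≡⟨ cong (_+_ a) (sym (sum-∷ʳ (b₁ ∷ b₂ ∷ R) c)) ⟩
      a + sum B                   ∎
      where
      open ≤-Reasoning
      rearrange : ∀ c s → c + 2 * s ≡ s + (s + c)
      rearrange = solve-∀
    M<K : All (_< a + sum B) M
    M<K = c+2s<K ∷ All.map (λ m<a → <-≤-trans m<a (m≤m+n a (sum B))) <a
    M-fresh : All (_∉ a +2Σ B) M
    M-fresh = s-fresh ∷ All.map (λ m<a {t} _ eq → <⇒≱ m<a (≤-trans (m≤m+n a (2 * t)) (≤-reflexive (sym eq)))) <a
    M-signed : All (λ m → SignedSum (length B) (B ∷ʳ a) ((a + sum B) ⊖ m)) M
    M-signed = ∈⇒SignedSum-∷ʳ-∷ʳ s∈ ∷ All.tabulate ∈⇒SignedSum-∷ʳ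

subsetSums-lowerBound : ∀ {b₁ b₂ c R} → Reverse R →
  AllPairs _<_ ((b₁ ∷ b₂ ∷ R) ∷ʳ c) → All Odd ((b₁ ∷ b₂ ∷ R) ∷ʳ c) →
  ∃[ ts ] DistinctSubsetSums ((b₁ ∷ b₂ ∷ R) ∷ʳ c) ts ×
          length ((b₁ ∷ b₂ ∷ R) ∷ʳ c) * length ((b₁ ∷ b₂ ∷ R) ∷ʳ c) ≤ suc (length ts)
subsetSums-lowerBound {b₁} {b₂} {c} [] sorted odds
  with AllPairs-∷ʳ⁻ (b₁ ∷ b₂ ∷ []) sorted | Allₚ.++⁻ (b₁ ∷ b₂ ∷ []) odds
... | sorted₂ , <c | odds₂ , c-odd ∷ [] =
  map (_+_ c) S ++ S , subsetSums-∷ʳ S-distinct S-distinct (smallSubsetSums-∉ sorted₂ odds₂ <c c-odd) , ≤-refl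
  where
  S : List ℕ
  S = smallSubsetSums b₁ (b₂ ∷ [])
  S-distinct : DistinctSubsetSums (b₁ ∷ b₂ ∷ []) S
  S-distinct = smallSubsetSums-distinct sorted₂ odds₂
subsetSums-lowerBound {b₁} {b₂} {c} (R ∶ rs ∶ʳ d) sorted odds
  with AllPairs-∷ʳ⁻ ((b₁ ∷ b₂ ∷ R) ∷ʳ d) sorted | Allₚ.++⁻ ((b₁ ∷ b₂ ∷ R) ∷ʳ d) odds
... | sorted₀ , <c | odds₀ , c-odd ∷ []
  with subsetSums-lowerBound rs sorted₀ odds₀
     | extraSubsetSum sorted₀ odds₀ (All.lookup <c (∈-++⁺ʳ (b₁ ∷ b₂ ∷ R) (here refl))) c-odd
... | ts , ts-distinct , ts-bound | e , e∈ , e∉ , small<e =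
  map (_+_ c) ts ++ S , subsetSums-∷ʳ ts-distinct S-distinct S∉ , bound
  where
  B₀ : List ℕ
  B₀ = (b₁ ∷ b₂ ∷ R) ∷ʳ d
  S : List ℕ
  S = e ∷ smallSubsetSums b₁ ((b₂ ∷ R) ∷ʳ d)
  small : DistinctSubsetSums B₀ (smallSubsetSums b₁ ((b₂ ∷ R) ∷ʳ d))
  small = smallSubsetSums-distinct sorted₀ odds₀
  S-distinct : DistinctSubsetSums B₀ S
  S-distinct = (All.map >⇒≢ small<e ∷ proj₁ small) , (e∈ ∷ proj₂ small)
  S∉ : All (_∉ c +Σ B₀) S
  S∉ = e∉ ∷ smallSubsetSums-∉ sorted₀ odds₀ <c c-odd
  square-suc : ∀ n → suc n * suc n ≡ n * n + suc (2 * n)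
  square-suc = solve-∀
  bound : length (B₀ ∷ʳ c) * length (B₀ ∷ʳ c) ≤ suc (length (map (_+_ c) ts ++ S))
  bound = begin
    length (B₀ ∷ʳ c) * length (B₀ ∷ʳ c)        ≡⟨ cong (λ n → n * n) (length-∷ʳ B₀ c) ⟩
    suc (length B₀) * suc (length B₀)          ≡⟨ square-suc (length B₀) ⟩
    length B₀ * length B₀ + suc (2 * length B₀) ≤⟨ +-monoˡ-≤ _ ts-bound ⟩
    suc (length ts + suc (2 * length B₀))       ≡⟨ cong (λ l → suc (length ts + suc l))
                                                        (sym (length-smallSubsetSums b₁ ((b₂ ∷ R) ∷ʳ d))) ⟩
    suc (length ts + length S)                  ≡⟨ cong (λ l → suc (l + length S)) (sym (length-map (_+_ c) ts)) ⟩
    suc (length (map (_+_ c) ts) + length S)    ≡⟨ cong suc (sym (length-++ (map (_+_ c) ts))) ⟩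
    suc (length (map (_+_ c) ts ++ S))          ∎
    where open ≤-Reasoning

subsetSums⇒SignedSums : DistinctSubsetSums bs ts →
  Unique (map (λ t → sum bs ⊖ 2 * t) ts) × All (SignedSum (length bs) bs) (map (λ t → sum bs ⊖ 2 * t) ts)
subsetSums⇒SignedSums {bs} (ts-unique , ts-sums) =
  Unique.map⁺ injective ts-unique , Allₚ.map⁺ (All.map signed ts-sums)
  where
  injective : sum bs ⊖ 2 * t ≡ sum bs ⊖ 2 * u → t ≡ u
  injective {t} {u} eq =
    *-cancelˡ-≡ t u 2 (sym (+-cancelˡ-≡ (sum bs) _ _ (m⊖n≡p⊖q⇒m+q≡p+n (sum bs) (2 * t) (sum bs) (2 * u) eq)))
  signed : SubsetSum bs t → SignedSum (length bs) bs (sum bs ⊖ 2 * t)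
  signed {t} (u , σ) = u , t , Split⇒Signing σ , m+q≡p+n⇒m⊖n≡p⊖q (sum bs) (2 * t) u t (begin
    sum bs + t    ≡⟨ cong (λ Σ → Σ + t) (sym (Split-sum σ)) ⟩
    u + t + t     ≡⟨ rearrange u t ⟩
    u + 2 * t     ∎)
    where
    open ≡-Reasoning
    rearrange : ∀ u t → u + t + t ≡ u + 2 * t
    rearrange = solve-∀

SumsetBounds : ℕ → List ℤ → List ℤ → Set
SumsetBounds h xs ys =
  card (restrictedSignedSumset h xs) + (2 * h + 2) ≤ card (restrictedSignedSumset h ys)
  × h * h + 2 * h + 1 ≤ card (restrictedSignedSumset h ys)

signedSumset-∷ʳ-bounds : ∀ {h} → length bs ≡ h → 3 ≤ h → AllPairs _<_ (bs ∷ʳ a) → All Odd (bs ∷ʳ a) →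
  SumsetBounds h (map +_ bs) (map +_ (bs ∷ʳ a))
signedSumset-∷ʳ-bounds {bs} {a} refl 3≤h sorted odds
  with ∷ʳ-shape {bs} 3≤h | AllPairs-∷ʳ⁻ bs sorted | Allₚ.++⁻ bs odds
... | b₁ , b₂ , R , c , refl | sortedB , <a | oddsB , _
  with subsetSums-lowerBound (reverseView R) sortedB oddsB
... | ts , ts-distinct , ts-bound =
  card-signedSumset-∷ʳ sortedB oddsB c<a (deduplicate-! _)
    (All.tabulate (∈restricted⇒SignedSum _ ∘ ∈-deduplicate⁻ ℤ._≟_ _)) ,
  ≤-trans arith (uncurry (card-signedSumset-∷ʳ sortedB oddsB c<a) (subsetSums⇒SignedSums ts-distinct))
  where
  B : List ℕ
  B = (b₁ ∷ b₂ ∷ R) ∷ʳ c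
  c<a : c < a
  c<a = All.lookup <a (∈-++⁺ʳ (b₁ ∷ b₂ ∷ R) (here refl))
  rearrange₁ : ∀ h → h * h + 2 * h + 1 ≡ h * h + (2 * h + 1)
  rearrange₁ = solve-∀
  rearrange₂ : ∀ h t → suc t + (2 * h + 1) ≡ t + (2 * h + 2)
  rearrange₂ = solve-∀
  arith : length B * length B + 2 * length B + 1 ≤ length (map (λ t → sum B ⊖ 2 * t) ts) + (2 * length B + 2)
  arith = begin
    length B * length B + 2 * length B + 1    ≡⟨ rearrange₁ (length B) ⟩
    length B * length B + (2 * length B + 1)  ≤⟨ +-monoˡ-≤ _ ts-bound ⟩
    suc (length ts) + (2 * length B + 1)      ≡⟨ rearrange₂ (length B) (length ts) ⟩
    length ts + (2 * length B + 2)            ≡⟨ cong (λ l → l + (2 * length B + 2)) (sym (length-map _ ts)) ⟩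
    length (map (λ t → sum B ⊖ 2 * t) ts) + (2 * length B + 2) ∎
    where open ≤-Reasoning

lemma7 : (h : ℕ) → 3 ≤ h → (a : Fin (suc h) → ℕ) →
    (∀ i → 0 < a i) → (∀ i → a i % 2 ≡ 1) →
    (∀ (i : Fin h) → a (inject₁ i) < a (suc i)) →
    (card (restrictedSignedSumset h (toList (a ∘ inject₁)))
       + (2 * h + 2) ≤ card (restrictedSignedSumset h (toList a)))
    × (h * h + 2 * h + 1 ≤ card (restrictedSignedSumset h (toList a)))
lemma7 h 3≤h a _ a-odd a-increasing =
  subst₂ (SumsetBounds h) (sym (toList-tabulate (a ∘ inject₁)))
         (sym (trans (toList-tabulate a) (cong (map (+_)) (tabulate-∷ʳ a))))
    (signedSumset-∷ʳ-bounds (length-tabulate (a ∘ inject₁)) 3≤h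
      (subst (AllPairs _<_) (tabulate-∷ʳ a) (Linked⇒AllPairs <-trans (tabulate-Linked a a-increasing)))
      (subst (All Odd) (tabulate-∷ʳ a) (Allₚ.tabulate⁺ {f = a} (odd ∘ a-odd))))
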